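{- Let $F$ be a field. For any non-commuting pairs $(u,v)$ and $(u',v')$ in $H(F)$ there is an isomorphism $f_{(u,v),(u',v')}$ from $F_{(u,v)}$ onto $F_{(u',v')}$, and this family of isomorphisms is functorial: (1) for every non-commuting pair $(u,v)$, $f_{(u,v),(u,v)}$ is the identity; (2) for any three non-commuting pairs $(u,v),(u',v'),(u'',v'')$, $f_{(u,v),(u'',v'')}=f_{(u',v'),(u'',v'')}\circ f_{(u,v),(u',v')}$.
   Context: For a field $F$, $H(F)$ is the group under matrix multiplication of all matrices $h(a,b,c)=\begin{pmatrix}1&a&c\\0&1&b\\0&0&1\end{pmatrix}$, $a,b,c\in F$, with center $Z(H(F))=\{h(0,0,c):c\in F\}$. Commutators are $[x,y]=x^{ -1}y^{ -1}xy$. For a non-commuting pair $u,v\in H(F)$, $F_{(u,v)}$ is the structure $(Z(H(F)),\oplus,\otimes_{(u,v)})$ where $\oplus$ is the group multiplication restricted to the center and $\otimes_{(u,v)}$ is the set of triples $(x,y,z)$ of central elements such that there exist $x',y'\in H(F)$ with $[x',u]=[y',v]=1$, $[x',v]=x$, $[u,y']=y$ and $[x',y']=z$; this is a field isomorphic to $F$. -}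

module Defs where

open import Level using (Level; _⊔_; suc)
open import Algebra.Bundles using (CommutativeRing)
open import Data.Product using (Σ; ∃; _×_; _,_; proj₁)
open import Relation.Nullary using (¬_)
open import Relation.Binary.Bundles using (Setoid)
open import Relation.Binary.Structures using (IsEquivalence)
open import Function.Bundles using (Bijection)
open import Function.Base using (_∘_)

record Field (c ℓ : Level) : Set (suc (c ⊔ ℓ)) where
  field
    commutativeRing : CommutativeRing c ℓ
  open CommutativeRing commutativeRing public
  field
    0≉1 : ¬ (0# ≈ 1#)
    inverse : ∀ x → ¬ (x ≈ 0#) → ∃ λ y → x * y ≈ 1#

module Heisenberg {c ℓ : Level} (F : Field c ℓ) where
  open Field F

  -- h(a,b,c) = [[1,a,c],[0,1,b],[0,0,1]]
  record H : Set c where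
    constructor h
    field
      ha : Carrier
      hb : Carrier
      hc : Carrier
  open H public

  _≈H_ : H → H → Set ℓ
  x ≈H y = (ha x ≈ ha y) × (hb x ≈ hb y) × (hc x ≈ hc y)

  -- matrix multiplication: h(a,b,c) h(a',b',c') = h(a+a', b+b', c+c'+ab')
  _·_ : H → H → H
  h a b c · h a' b' c' = h (a + a') (b + b') (c + c' + a * b')

  1H : H
  1H = h 0# 0# 0#

  inv : H → H
  inv (h a b c) = h (- a) (- b) (a * b - c)

  [_,_] : H → H → H
  [ x , y ] = ((inv x · inv y) · x) · y

  IsCentral : H → Set (c ⊔ ℓ)
  IsCentral g = ∀ y → (g · y) ≈H (y · g)

  Z : Set (c ⊔ ℓ)
  Z = Σ H IsCentral

  ≈H-isEquivalence : IsEquivalence _≈H_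
  ≈H-isEquivalence = record
    { refl = refl , refl , refl
    ; sym = λ { (p , q , r) → sym p , sym q , sym r }
    ; trans = λ { (p , q , r) (p' , q' , r') → trans p p' , trans q q' , trans r r' }
    }

  ZSetoid : Setoid (c ⊔ ℓ) ℓ
  ZSetoid = record
    { Carrier = Z
    ; _≈_ = λ x y → proj₁ x ≈H proj₁ y
    ; isEquivalence = record
      { refl = IsEquivalence.refl ≈H-isEquivalence
      ; sym = IsEquivalence.sym ≈H-isEquivalence
      ; trans = IsEquivalence.trans ≈H-isEquivalence
      }
    }

  _≈Z_ : Z → Z → Set ℓ
  x ≈Z y = proj₁ x ≈H proj₁ y

  NCPair : Set (c ⊔ ℓ)
  NCPair = Σ (H × H) λ { (u , v) → ¬ ((u · v) ≈H (v · u)) }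

  Plus : Z → Z → Z → Set ℓ
  Plus x y z = (proj₁ x · proj₁ y) ≈H proj₁ z

  Times : NCPair → Z → Z → Z → Set (c ⊔ ℓ)
  Times ((u , v) , _) x y z =
    Σ H λ x' → Σ H λ y' →
      ([ x' , u ] ≈H 1H) × ([ y' , v ] ≈H 1H) ×
      ([ x' , v ] ≈H proj₁ x) × ([ u , y' ] ≈H proj₁ y) ×
      ([ x' , y' ] ≈H proj₁ z)

  IsIso : NCPair → NCPair → Bijection ZSetoid ZSetoid → Set (c ⊔ ℓ)
  IsIso p q f =
    (∀ x y z → (Plus x y z → Plus (g x) (g y) (g z)) × (Plus (g x) (g y) (g z) → Plus x y z)) ×
    (∀ x y z → (Times p x y z → Times q (g x) (g y) (g z)) × (Times q (g x) (g y) (g z) → Times p x y z))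
    where g = Bijection.to f

-- Everything is governed by the symplectic form ω(x,y) = a_x b_y - a_y b_x:
--   * x and y commute iff ω(x,y) = 0, and [x,y] = h(0,0,ω(x,y));
--   * hence the center consists of the elements ζ(t) = h(0,0,t), and the
--     value map z ↦ t identifies ⊕ with addition of F;
--   * for a non-commuting pair p = (u,v) the determinant d_p = ω(u,v) is
--     nonzero, and (by a Plücker-type identity for ω, and explicit witnesses
--     x' = (x/d_p)•u, y' = (y/d_p)•v) z = x ⊗_p y holds iff z·d_p = x·y.
-- So F_p is F with the product x·y/d_p, and rescaling the values by the
-- transition factor d_q/d_p is an isomorphism F_p → F_q.  Transition
-- factors satisfy d_p/d_p = 1 and (d_q/d_p)(d_r/d_q) = d_r/d_p, which gives
-- the two functoriality laws.
module Submission where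

open import Defs
open import Data.Product using (Σ; _×_)
open import Function.Bundles using (Bijection)
open import Data.Product using (_,_; proj₁; proj₂)
open import Level using (Level)
open import Data.Nat as ℕ using (ℕ; zero; suc)
open import Data.Integer as ℤ using (ℤ; +_; -[1+_]; _⊖_; _◃_; ∣_∣; sign)
open import Data.Sign as Sign using (Sign)
import Data.Nat.Properties as ℕ
import Data.Integer.Properties as ℤ
open import Data.Maybe using (Maybe; just; nothing)
open import Relation.Nullary using (yes; no; ¬_)
open import Relation.Binary.Structures using (IsEquivalence)
import Relation.Binary.PropositionalEquality as ≡
open import Function.Bundles using (Inverse; _⇔_; mk⇔; Equivalence)
open import Function.Properties.Inverse using (Inverse⇒Bijection)
open import Function.Construct.Composition using (_⇔-∘_)
open import Function.Construct.Symmetry using (⇔-sym)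
import Algebra.Solver.Ring.AlmostCommutativeRing as AlmostCommutativeRing
open import Algebra.Bundles using (CommutativeRing)

-- Every commutative ring R receives the ring homomorphism ℤ → R, n ↦ n·1.
-- Instantiating the standard ring solver with integer coefficients along
-- it decides polynomial identities in R involving subtraction.
module IntegerCoefficientSolver {c ℓ : Level} (R : CommutativeRing c ℓ) where
  open CommutativeRing R
  open import Algebra.Properties.Semiring.Mult.TCOptimised semiring
    using (×-cong; 1+×; ×-homo-+; ×1-homo-*) renaming (_×_ to _×ₙ_)
  open import Algebra.Properties.Ring ring using (-‿distribˡ-*; -‿distribʳ-*; -0#≈0#; -‿involutive)
  open import Algebra.Properties.AbelianGroup +-abelianGroup using (⁻¹-∙-comm)
  open import Algebra.Properties.CommutativeSemigroup +-commutativeSemigroup using (interchange)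
  open import Relation.Binary.Reasoning.Setoid setoid

  -- the image n·1 of a natural number; the optimised multiple makes 1·1
  -- definitionally 1#, so the homomorphism preserves 1 by refl
  fromℕ : ℕ → Carrier
  fromℕ n = n ×ₙ 1#

  signed : Sign → Carrier → Carrier
  signed Sign.+ x = x
  signed Sign.- x = - x

  signed-cong : ∀ s {x y} → x ≈ y → signed s x ≈ signed s y
  signed-cong Sign.+ x≈y = x≈y
  signed-cong Sign.- x≈y = -‿cong x≈y

  signed-* : ∀ s t x y → signed (s Sign.* t) (x * y) ≈ signed s x * signed t y
  signed-* Sign.+ Sign.+ x y = refl
  signed-* Sign.+ Sign.- x y = -‿distribʳ-* x y
  signed-* Sign.- Sign.+ x y = -‿distribˡ-* x y
  signed-* Sign.- Sign.- x y = begin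
    x * y         ≈⟨ -‿involutive (x * y) ⟨
    - (- (x * y)) ≈⟨ -‿cong (-‿distribˡ-* x y) ⟩
    - (- x * y)   ≈⟨ -‿distribʳ-* (- x) y ⟩
    - x * - y     ∎

  ⟦_⟧ℤ : ℤ → Carrier
  ⟦ i ⟧ℤ = signed (sign i) (fromℕ ∣ i ∣)

  ⟦◃⟧ : ∀ s n → ⟦ s ◃ n ⟧ℤ ≈ signed s (fromℕ n)
  ⟦◃⟧ Sign.+ zero    = refl
  ⟦◃⟧ Sign.- zero    = sym -0#≈0#
  ⟦◃⟧ Sign.+ (suc n) = refl
  ⟦◃⟧ Sign.- (suc n) = refl

  -- integer addition is computed through m ⊖ n, which maps to m·1 - n·1
  ⟦⊖⟧ : ∀ m n → ⟦ m ⊖ n ⟧ℤ ≈ fromℕ m - fromℕ n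
  ⟦⊖⟧ m zero = begin
    ⟦ m ⊖ 0 ⟧ℤ       ≡⟨ ≡.cong ⟦_⟧ℤ (ℤ.⊖-≥ {m} {0} ℕ.z≤n) ⟩
    fromℕ m          ≈⟨ +-identityʳ _ ⟨
    fromℕ m + 0#     ≈⟨ +-congˡ -0#≈0# ⟨
    fromℕ m - 0#     ∎
  ⟦⊖⟧ zero (suc n) = sym (+-identityˡ _)
  ⟦⊖⟧ (suc m) (suc n) = begin
    ⟦ suc m ⊖ suc n ⟧ℤ            ≡⟨ ≡.cong ⟦_⟧ℤ (ℤ.[1+m]⊖[1+n]≡m⊖n m n) ⟩
    ⟦ m ⊖ n ⟧ℤ                    ≈⟨ ⟦⊖⟧ m n ⟩
    M - N                         ≈⟨ +-identityˡ _ ⟨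
    0# + (M - N)                  ≈⟨ +-congʳ (-‿inverseʳ 1#) ⟨
    (1# - 1#) + (M - N)           ≈⟨ interchange 1# M (- 1#) (- N) ⟨
    (1# + M) + (- 1# - N)         ≈⟨ +-congˡ (⁻¹-∙-comm 1# N) ⟩
    (1# + M) - (1# + N)           ≈⟨ +-cong (1+× m 1#) (-‿cong (1+× n 1#)) ⟨
    fromℕ (suc m) - fromℕ (suc n) ∎
    where M = fromℕ m ; N = fromℕ n

  ⟦+⟧ : ∀ i j → ⟦ i ℤ.+ j ⟧ℤ ≈ ⟦ i ⟧ℤ + ⟦ j ⟧ℤ
  ⟦+⟧ (+ m)    (+ n)    = ×-homo-+ 1# m n
  ⟦+⟧ (+ m)    -[1+ n ] = ⟦⊖⟧ m (suc n)
  ⟦+⟧ -[1+ m ] (+ n)    = trans (⟦⊖⟧ n (suc m)) (+-comm _ _)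
  ⟦+⟧ -[1+ m ] -[1+ n ] = begin
    - fromℕ (suc (suc (m ℕ.+ n)))       ≈⟨ -‿cong (×-cong (≡.cong suc (ℕ.+-suc m n)) refl) ⟨
    - fromℕ (suc m ℕ.+ suc n)           ≈⟨ -‿cong (×-homo-+ 1# (suc m) (suc n)) ⟩
    - (fromℕ (suc m) + fromℕ (suc n))   ≈⟨ ⁻¹-∙-comm _ _ ⟨
    - fromℕ (suc m) - fromℕ (suc n)     ∎

  ⟦*⟧ : ∀ i j → ⟦ i ℤ.* j ⟧ℤ ≈ ⟦ i ⟧ℤ * ⟦ j ⟧ℤ
  ⟦*⟧ i j = begin
    ⟦ s ◃ (∣ i ∣ ℕ.* ∣ j ∣) ⟧ℤ              ≈⟨ ⟦◃⟧ s (∣ i ∣ ℕ.* ∣ j ∣) ⟩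
    signed s (fromℕ (∣ i ∣ ℕ.* ∣ j ∣))      ≈⟨ signed-cong s (×1-homo-* ∣ i ∣ ∣ j ∣) ⟩
    signed s (fromℕ ∣ i ∣ * fromℕ ∣ j ∣)    ≈⟨ signed-* (sign i) (sign j) _ _ ⟩
    ⟦ i ⟧ℤ * ⟦ j ⟧ℤ                          ∎
    where s = sign i Sign.* sign j

  ⟦-⟧ : ∀ i → ⟦ ℤ.- i ⟧ℤ ≈ - ⟦ i ⟧ℤ
  ⟦-⟧ (+ zero)  = sym -0#≈0#
  ⟦-⟧ (+ suc n) = refl
  ⟦-⟧ -[1+ n ]  = sym (-‿involutive _)

  homomorphism : ℤ.+-*-rawRing AlmostCommutativeRing.-Raw-AlmostCommutative⟶
                   AlmostCommutativeRing.fromCommutativeRing R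
  homomorphism = record
    { ⟦_⟧ = ⟦_⟧ℤ ; +-homo = ⟦+⟧ ; *-homo = ⟦*⟧ ; -‿homo = ⟦-⟧ ; 0-homo = refl ; 1-homo = refl }

  equal? : ∀ i j → Maybe (⟦ i ⟧ℤ ≈ ⟦ j ⟧ℤ)
  equal? i j with i ℤ.≟ j
  ... | yes ≡.refl = just refl
  ... | no _       = nothing

  open import Algebra.Solver.Ring ℤ.+-*-rawRing (AlmostCommutativeRing.fromCommutativeRing R)
    homomorphism equal? public using (solve; _:=_; _:+_; _:*_; :-_; _:-_; con)

module UnitScaling {c ℓ : Level} (R : CommutativeRing c ℓ) where
  open CommutativeRing R
  open IntegerCoefficientSolver R
  open import Relation.Binary.Reasoning.Setoid setoid

  *-unit-cancel : ∀ {κ ι} → κ * ι ≈ 1# → ∀ a → (a * κ) * ι ≈ a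
  *-unit-cancel {κ} {ι} κι≈1 a = begin
    (a * κ) * ι  ≈⟨ *-assoc a κ ι ⟩
    a * (κ * ι)  ≈⟨ *-congˡ κι≈1 ⟩
    a * 1#       ≈⟨ *-identityʳ a ⟩
    a            ∎

  *-cancelʳ-unit : ∀ {κ ι a b} → κ * ι ≈ 1# → a * κ ≈ b * κ → a ≈ b
  *-cancelʳ-unit {κ} {ι} {a} {b} κι≈1 aκ≈bκ = begin
    a            ≈⟨ *-unit-cancel κι≈1 a ⟨
    (a * κ) * ι  ≈⟨ *-congʳ aκ≈bκ ⟩
    (b * κ) * ι  ≈⟨ *-unit-cancel κι≈1 b ⟩
    b            ∎

  unit-square : ∀ {κ ι} → κ * ι ≈ 1# → (κ * κ) * (ι * ι) ≈ 1#
  unit-square {κ} {ι} κι≈1 = begin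
    (κ * κ) * (ι * ι)  ≈⟨ solve 2 (λ x y → (x :* x) :* (y :* y) := (x :* y) :* (x :* y)) refl κ ι ⟩
    (κ * ι) * (κ * ι)  ≈⟨ *-cong κι≈1 κι≈1 ⟩
    1# * 1#            ≈⟨ *-identityʳ 1# ⟩
    1#                 ∎

  scaled-sum⇔ : ∀ {κ ι a b c} → κ * ι ≈ 1# → (a + b ≈ c) ⇔ (a * κ + b * κ ≈ c * κ)
  scaled-sum⇔ {κ} {ι} {a} {b} {c} κι≈1 = mk⇔
    (λ a+b≈c → trans (sym (distribʳ κ a b)) (*-congʳ a+b≈c))
    (λ e → *-cancelʳ-unit κι≈1 (trans (distribʳ κ a b) e))

  scaled-product⇔ : ∀ {κ ι a b x y z} → κ * ι ≈ 1# → b ≈ a * κ →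
                    (z * a ≈ x * y) ⇔ ((z * κ) * b ≈ (x * κ) * (y * κ))
  scaled-product⇔ {κ} {ι} {a} {b} {x} {y} {z} κι≈1 b≈aκ = mk⇔
    (λ e → trans left-side (trans (*-congʳ e) (sym (regroup x y))))
    (λ e → *-cancelʳ-unit (unit-square κι≈1) (trans (sym left-side) (trans e (regroup x y))))
    where
    regroup : ∀ p q → (p * κ) * (q * κ) ≈ (p * q) * (κ * κ)
    regroup p q = solve 3 (λ p q l → (p :* l) :* (q :* l) := (p :* q) :* (l :* l)) refl p q κ
    left-side : (z * κ) * b ≈ (z * a) * (κ * κ)
    left-side = trans (*-congˡ b≈aκ) (regroup z a)

module HeisenbergFields {c ℓ : Level} (F : Field c ℓ) where
  open Field F
  open IntegerCoefficientSolver commutativeRing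
  open UnitScaling commutativeRing
  open Heisenberg F
  open import Algebra.Properties.Group +-group using (x∙y⁻¹≈ε⇒x≈y; x≈y⇒x∙y⁻¹≈ε)
  open import Relation.Binary.Reasoning.Setoid setoid
  open IsEquivalence ≈H-isEquivalence using () renaming (sym to ≈H-sym; trans to ≈H-trans)

  ω : H → H → Carrier
  ω x y = ha x * hb y - ha y * hb x

  ω-self : ∀ x → ω x x ≈ 0#
  ω-self x = -‿inverseʳ (ha x * hb x)

  -- two elements commute iff ω vanishes on them: the products differ only
  -- in the corner entry, by ω
  commute⇔ω≈0 : ∀ x y → ((x · y) ≈H (y · x)) ⇔ (ω x y ≈ 0#)
  commute⇔ω≈0 x@(h a b c) y@(h a' b' c') = mk⇔ to from
    where
    to : (x · y) ≈H (y · x) → ω x y ≈ 0#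
    to (_ , _ , corner) = begin
      a * b' - a' * b                               ≈⟨ solve 6 (λ a b c a' b' c' →
                                                          a :* b' :- a' :* b
                                                       := ((c :+ c') :+ a :* b') :- ((c' :+ c) :+ a' :* b))
                                                       refl a b c a' b' c' ⟩
      ((c + c') + a * b') - ((c' + c) + a' * b)     ≈⟨ x≈y⇒x∙y⁻¹≈ε corner ⟩
      0#                                            ∎
    from : ω x y ≈ 0# → (x · y) ≈H (y · x)
    from ω≈0 = +-comm a a' , +-comm b b' , +-cong (+-comm c c') (x∙y⁻¹≈ε⇒x≈y _ _ ω≈0)

  commutator : ∀ x y → [ x , y ] ≈H h 0# 0# (ω x y)
  commutator (h a b c) (h a' b' c') =
    solve 2 (λ a a' → ((:- a :+ :- a') :+ a) :+ a' := con (+ 0)) refl a a' ,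
    solve 2 (λ b b' → ((:- b :+ :- b') :+ b) :+ b' := con (+ 0)) refl b b' ,
    solve 6 (λ a b c a' b' c' →
       ((((a :* b :- c) :+ (a' :* b' :- c') :+ (:- a) :* (:- b')) :+ c :+ (:- a :- a') :* b)
         :+ c' :+ ((:- a :- a') :+ a) :* b')
       := a :* b' :- a' :* b) refl a b c a' b' c'

  ζ : Carrier → H
  ζ t = h 0# 0# t

  ζ-central : ∀ t → IsCentral (ζ t)
  ζ-central t y = Equivalence.from (commute⇔ω≈0 (ζ t) y)
    (solve 2 (λ a b → con (+ 0) :* b :- a :* con (+ 0) := con (+ 0)) refl (ha y) (hb y))

  embed : Carrier → Z
  embed t = ζ t , ζ-central t

  val : Z → Carrier
  val z = hc (proj₁ z)

  embed-cong : ∀ {s t} → s ≈ t → embed s ≈Z embed t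
  embed-cong s≈t = refl , refl , s≈t

  -- a central element commutes with h(0,1,0) and h(1,0,0), so its first two
  -- entries vanish
  central-form : (z : Z) → proj₁ z ≈H ζ (val z)
  central-form (x@(h a b c) , central) = a≈0 , b≈0 , refl
    where
    a≈0 : a ≈ 0#
    a≈0 = begin
      a                ≈⟨ solve 2 (λ a b → a := a :* con (+ 1) :- con (+ 0) :* b) refl a b ⟩
      ω x (h 0# 1# 0#) ≈⟨ Equivalence.to (commute⇔ω≈0 x _) (central (h 0# 1# 0#)) ⟩
      0#               ∎
    b≈0 : b ≈ 0#
    b≈0 = begin
      b                ≈⟨ solve 2 (λ a b → b := con (+ 1) :* b :- a :* con (+ 0)) refl a b ⟩
      ω (h 1# 0# 0#) x ≈⟨ Equivalence.to (commute⇔ω≈0 _ x) (≈H-sym (central (h 1# 0# 0#))) ⟩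
      0#               ∎

  ≈Z-by-val : (x y : Z) → val x ≈ val y → x ≈Z y
  ≈Z-by-val x y vx≈vy =
    ≈H-trans (central-form x) (≈H-trans (refl , refl , vx≈vy) (≈H-sym (central-form y)))

  ζ-equals : ∀ {x s} → x ≈H ζ s → (z : Z) → (x ≈H proj₁ z) ⇔ (s ≈ val z)
  ζ-equals {x} {s} x≈ζs z = mk⇔
    (λ x≈z → trans (sym (proj₂ (proj₂ x≈ζs))) (proj₂ (proj₂ x≈z)))
    (λ s≈vz → ≈H-trans x≈ζs (≈H-trans (refl , refl , s≈vz) (≈H-sym (central-form z))))

  commutator≈ : ∀ x y (z : Z) → ([ x , y ] ≈H proj₁ z) ⇔ (ω x y ≈ val z)
  commutator≈ x y = ζ-equals (commutator x y)

  commutator≈1 : ∀ x y → ([ x , y ] ≈H 1H) ⇔ (ω x y ≈ 0#)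
  commutator≈1 x y = commutator≈ x y (embed 0#)

  plus⇔ : ∀ x y z → Plus x y z ⇔ (val x + val y ≈ val z)
  plus⇔ x y = ζ-equals sum-form
    where
    a≈0 : ∀ w → ha (proj₁ w) ≈ 0#
    a≈0 w = proj₁ (central-form w)
    b≈0 : ∀ w → hb (proj₁ w) ≈ 0#
    b≈0 w = proj₁ (proj₂ (central-form w))
    sum-form : (proj₁ x · proj₁ y) ≈H ζ (val x + val y)
    sum-form =
      trans (+-cong (a≈0 x) (a≈0 y)) (+-identityʳ 0#) ,
      trans (+-cong (b≈0 x) (b≈0 y)) (+-identityʳ 0#) ,
      trans (+-congˡ (trans (*-congʳ (a≈0 x)) (zeroˡ _))) (+-identityʳ _)

  plücker : ∀ w x y z → ω w x * ω y z ≈ ω w z * ω y x + ω w y * ω x z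
  plücker (h a b _) (h a' b' _) (h u₁ u₂ _) (h v₁ v₂ _) =
    solve 8 (λ a b a' b' u₁ u₂ v₁ v₂ →
         (a :* b' :- a' :* b) :* (u₁ :* v₂ :- v₁ :* u₂)
      := (a :* v₂ :- v₁ :* b) :* (u₁ :* b' :- a' :* u₂) :+ (a :* u₂ :- u₁ :* b) :* (a' :* v₂ :- v₁ :* b'))
      refl a b a' b' u₁ u₂ v₁ v₂

  _•_ : Carrier → H → H
  s • x = h (s * ha x) (s * hb x) 0#

  ω-•ˡ : ∀ s x y → ω (s • x) y ≈ s * ω x y
  ω-•ˡ s (h a b _) (h a' b' _) =
    solve 5 (λ s a b a' b' → (s :* a) :* b' :- a' :* (s :* b) := s :* (a :* b' :- a' :* b))
      refl s a b a' b'

  ω-•ʳ : ∀ s x y → ω x (s • y) ≈ s * ω x y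
  ω-•ʳ s (h a b _) (h a' b' _) =
    solve 5 (λ s a b a' b' → a :* (s :* b') :- (s :* a') :* b := s :* (a :* b' :- a' :* b))
      refl s a b a' b'

  det : NCPair → Carrier
  det ((u , v) , _) = ω u v

  det≉0 : ∀ p → ¬ (det p ≈ 0#)
  det≉0 ((u , v) , noncommuting) ω≈0 = noncommuting (Equivalence.from (commute⇔ω≈0 u v) ω≈0)

  det⁻¹ : NCPair → Carrier
  det⁻¹ p = proj₁ (inverse (det p) (det≉0 p))

  det*det⁻¹ : ∀ p → det p * det⁻¹ p ≈ 1#
  det*det⁻¹ p = proj₂ (inverse (det p) (det≉0 p))

  det⁻¹*det : ∀ p → det⁻¹ p * det p ≈ 1#
  det⁻¹*det p = trans (*-comm _ _) (det*det⁻¹ p)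

  -- ⊗ in terms of values, forward: x' and y' are pinned down by ω, and the
  -- Plücker relation computes ω(x',y')·ω(u,v) = ω(x',v)·ω(u,y')
  times⇒ : ∀ p x y z → Times p x y z → val z * det p ≈ val x * val y
  times⇒ ((u , v) , _) x y z (x' , y' , [x',u]≈1 , _ , [x',v]≈x , [u,y']≈y , [x',y']≈z) = begin
    val z * ω u v                      ≈⟨ *-congʳ (Equivalence.to (commutator≈ x' y' z) [x',y']≈z) ⟨
    ω x' y' * ω u v                    ≈⟨ plücker x' y' u v ⟩
    ω x' v * ω u y' + ω x' u * ω y' v  ≈⟨ +-cong (*-cong (Equivalence.to (commutator≈ x' v x) [x',v]≈x)
                                                          (Equivalence.to (commutator≈ u y' y) [u,y']≈y))
                                                 (*-congʳ (Equivalence.to (commutator≈1 x' u) [x',u]≈1)) ⟩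
    val x * val y + 0# * ω y' v        ≈⟨ +-congˡ (zeroˡ _) ⟩
    val x * val y + 0#                 ≈⟨ +-identityʳ _ ⟩
    val x * val y                      ∎

  -- ⊗ in terms of values, backward: the witnesses x' = (x/d)•u, y' = (y/d)•v
  times⇐ : ∀ p x y z → val z * det p ≈ val x * val y → Times p x y z
  times⇐ p@((u , v) , _) x y z zd≈xy =
    x' , y' ,
    Equivalence.from (commutator≈1 x' u) (ω-•-self s u) ,
    Equivalence.from (commutator≈1 y' v) (ω-•-self t v) ,
    Equivalence.from (commutator≈ x' v x) (trans (ω-•ˡ s u v) (*-unit-cancel (det⁻¹*det p) (val x))) ,
    Equivalence.from (commutator≈ u y' y) (trans (ω-•ʳ t u v) (*-unit-cancel (det⁻¹*det p) (val y))) ,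
    Equivalence.from (commutator≈ x' y' z) ω[x',y']≈z
    where
    d = det p ; d⁻¹ = det⁻¹ p
    s = val x * d⁻¹ ; t = val y * d⁻¹
    x' = s • u ; y' = t • v
    ω-•-self : ∀ r w → ω (r • w) w ≈ 0#
    ω-•-self r w = trans (ω-•ˡ r w w) (trans (*-congˡ (ω-self w)) (zeroʳ r))
    ω[x',y']≈z : ω x' y' ≈ val z
    ω[x',y']≈z = begin
      ω x' y'                        ≈⟨ ω-•ˡ s u y' ⟩
      s * ω u y'                     ≈⟨ *-congˡ (ω-•ʳ t u v) ⟩
      s * (t * d)                    ≈⟨ *-congˡ (*-unit-cancel (det⁻¹*det p) (val y)) ⟩
      (val x * d⁻¹) * val y          ≈⟨ solve 3 (λ X i Y → (X :* i) :* Y := (X :* Y) :* i) refl (val x) d⁻¹ (val y) ⟩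
      (val x * val y) * d⁻¹          ≈⟨ *-congʳ zd≈xy ⟨
      (val z * d) * d⁻¹              ≈⟨ *-unit-cancel (det*det⁻¹ p) (val z) ⟩
      val z                          ∎

  times⇔ : ∀ p x y z → Times p x y z ⇔ (val z * det p ≈ val x * val y)
  times⇔ p x y z = mk⇔ (times⇒ p x y z) (times⇐ p x y z)

  rescale : Carrier → Z → Z
  rescale κ z = embed (val z * κ)

  rescale-cong : ∀ κ {x y} → x ≈Z y → rescale κ x ≈Z rescale κ y
  rescale-cong κ (_ , _ , vx≈vy) = embed-cong (*-congʳ vx≈vy)

  rescale-inverse : ∀ {κ ι x y} → ι * κ ≈ 1# → y ≈Z rescale ι x → rescale κ y ≈Z x
  rescale-inverse {κ} {ι} {x} {y} ικ≈1 (_ , _ , vy≈vxι) =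
    ≈Z-by-val (rescale κ y) x (trans (*-congʳ vy≈vxι) (*-unit-cancel ικ≈1 (val x)))

  rescaling : ∀ κ ι → κ * ι ≈ 1# → Inverse ZSetoid ZSetoid
  rescaling κ ι κι≈1 = record
    { to        = rescale κ
    ; from      = rescale ι
    ; to-cong   = λ {x} {y} → rescale-cong κ {x} {y}
    ; from-cong = λ {x} {y} → rescale-cong ι {x} {y}
    ; inverse   = (λ {x} {y} → rescale-inverse {κ} {ι} {x} {y} (trans (*-comm ι κ) κι≈1))
                , (λ {x} {y} → rescale-inverse {ι} {κ} {x} {y} κι≈1)
    }

  transition : NCPair → NCPair → Carrier
  transition p q = det⁻¹ p * det q

  transition-det : ∀ p q → det q ≈ det p * transition p q
  transition-det p q = begin
    det q                        ≈⟨ *-identityˡ (det q) ⟨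
    1# * det q                   ≈⟨ *-congʳ (det*det⁻¹ p) ⟨
    (det p * det⁻¹ p) * det q    ≈⟨ *-assoc _ _ _ ⟩
    det p * transition p q       ∎

  transition-refl : ∀ p → transition p p ≈ 1#
  transition-refl = det⁻¹*det

  transition-trans : ∀ p q r → transition p q * transition q r ≈ transition p r
  transition-trans p q r = begin
    (det⁻¹ p * det q) * (det⁻¹ q * det r)  ≈⟨ solve 4 (λ a b c e → (a :* b) :* (c :* e) := a :* ((b :* c) :* e))
                                                 refl (det⁻¹ p) (det q) (det⁻¹ q) (det r) ⟩
    det⁻¹ p * ((det q * det⁻¹ q) * det r)  ≈⟨ *-congˡ (*-congʳ (det*det⁻¹ q)) ⟩
    det⁻¹ p * (1# * det r)                 ≈⟨ *-congˡ (*-identityˡ (det r)) ⟩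
    transition p r                         ∎

  transition-inverse : ∀ p q → transition p q * transition q p ≈ 1#
  transition-inverse p q = trans (transition-trans p q p) (transition-refl p)

  fieldIso : NCPair → NCPair → Bijection ZSetoid ZSetoid
  fieldIso p q = Inverse⇒Bijection (rescaling (transition p q) (transition q p) (transition-inverse p q))

  fieldIso-isIso : ∀ p q → IsIso p q (fieldIso p q)
  fieldIso-isIso p q = (λ x y z → as-pair (plus-transport x y z)) , (λ x y z → as-pair (times-transport x y z))
    where
    κ = transition p q
    κι≈1 = transition-inverse p q
    as-pair : ∀ {a b} {A : Set a} {B : Set b} → A ⇔ B → (A → B) × (B → A)
    as-pair A⇔B = Equivalence.to A⇔B , Equivalence.from A⇔B
    plus-transport : ∀ x y z → Plus x y z ⇔ Plus (rescale κ x) (rescale κ y) (rescale κ z)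
    plus-transport x y z =
      ⇔-sym (plus⇔ (rescale κ x) (rescale κ y) (rescale κ z)) ⇔-∘ (scaled-sum⇔ κι≈1 ⇔-∘ plus⇔ x y z)
    times-transport : ∀ x y z → Times p x y z ⇔ Times q (rescale κ x) (rescale κ y) (rescale κ z)
    times-transport x y z =
      ⇔-sym (times⇔ q (rescale κ x) (rescale κ y) (rescale κ z))
        ⇔-∘ (scaled-product⇔ κι≈1 (transition-det p q) ⇔-∘ times⇔ p x y z)

  fieldIso-identity : ∀ p x → Bijection.to (fieldIso p p) x ≈Z x
  fieldIso-identity p x = ≈Z-by-val (rescale (transition p p) x) x (trans (*-congˡ (transition-refl p)) (*-identityʳ (val x)))

  fieldIso-composition : ∀ p q r x →
    Bijection.to (fieldIso p r) x ≈Z Bijection.to (fieldIso q r) (Bijection.to (fieldIso p q) x)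
  fieldIso-composition p q r x = embed-cong (begin
    val x * transition p r                         ≈⟨ *-congˡ (transition-trans p q r) ⟨
    val x * (transition p q * transition q r)      ≈⟨ *-assoc _ _ _ ⟨
    (val x * transition p q) * transition q r      ∎)

lemma3p1 : ∀ {c ℓ} (F : Field c ℓ) → let open Heisenberg F in
    Σ ((p q : NCPair) → Bijection ZSetoid ZSetoid) λ f →
      ((p q : NCPair) → IsIso p q (f p q)) ×
      ((p : NCPair) (x : Z) → Bijection.to (f p p) x ≈Z x) ×
      ((p q r : NCPair) (x : Z) →
        Bijection.to (f p r) x ≈Z Bijection.to (f q r) (Bijection.to (f p q) x))
lemma3p1 F = fieldIso , fieldIso-isIso , fieldIso-identity , fieldIso-composition
  where open HeisenbergFields F
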